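{- (Relative completeness of CPRHL.) Suppose the language of assertions is WPR-expressive. Then for every partial reverse Hoare triple $\{P\}\,C\,\{Q\}$ the following are equivalent: (1) $\{P\}\,C\,\{Q\}$ is valid; (2) $\{P\}\,C\,\{Q\}$ is provable in PRHL; (3) $\{P\}\,C\,\{Q\}$ is provable in CPRHL.
   Context: States $\sigma:\mathrm{Var}\to\mathbb{N}$; expressions $E ::= x\mid n\mid f(E,\dots,E)$; Boolean conditions $B ::= Q(E,\dots,E)\mid E=E\mid E\le E\mid\neg B\mid B\wedge B\mid B\vee B$; programs $C ::= \varepsilon\mid C'$, $C' ::= x:=E\mid C';C'\mid\mathtt{while}\ B\ \mathtt{do}\ C\mid C\ \mathtt{or}\ C$ ($\varepsilon$ the empty program; $C_0;C_1$ denotes $C_i$ when $C_{1-i}=\varepsilon$); assertions are first-order formulas over Boolean conditions interpreted over $\mathbb{N}$; $P\models Q$ is semantic entailment; $P[x:=E]$ is substitution. Small-step semantics: $\langle x:=E,\sigma\rangle\to\langle\varepsilon,\sigma[x\mapsto[\![E]\!]\sigma]\rangle$; $\langle\mathtt{while}\ B\ \mathtt{do}\ C,\sigma\rangle\to\langle C;\mathtt{while}\ B\ \mathtt{do}\ C,\sigma\rangle$ if $B$ holds in $\sigma$, else $\to\langle\varepsilon,\sigma\rangle$; $\langle C_0;C_1,\sigma\rangle\to\langle C_0';C_1,\sigma'\rangle$ if $\langle C_0,\sigma\rangle\to\langle C_0',\sigma'\rangle$; $\langle C_0\ \mathtt{or}\ C_1,\sigma\rangle\to\langle C_i,\sigma\rangle$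 ($i=0,1$); $\to^{*}$ the reflexive-transitive closure. Validity: $\{P\}C\{Q\}$ is valid if for all $\sigma'\models Q$ and all $\sigma$ with $\langle C,\sigma\rangle\to^{*}\langle\varepsilon,\sigma'\rangle$, $\sigma\models P$. WPR-expressive: for every $Q$ and $C$ there is an assertion $P$ with $\sigma\models P$ iff $\exists\sigma'(\langle C,\sigma\rangle\to^{*}\langle\varepsilon,\sigma'\rangle\wedge\sigma'\models Q)$. PRHL: finite derivation trees with leaves Axiom or Assign, rules (Axiom) $\{Q\}\varepsilon\{Q\}$; (Assign) $\{Q[x:=E]\}x:=E\{Q\}$; (Seq) from $\{P\}C_0\{R\},\{R\}C_1\{Q\}$ infer $\{P\}C_0;C_1\{Q\}$; (Cons) from $\{P\}C\{Q\}$ infer $\{P'\}C\{Q'\}$ if $P\models P'$, $Q'\models Q$; (Or) from $\{P\}C_0\{Q\},\{P\}C_1\{Q\}$ infer $\{P\}C_0\ \mathtt{or}\ C_1\{Q\}$; (While) from $\{B\to P\}C\{P\}$ infer $\{P\}\mathtt{while}\ B\ \mathtt{do}\ C\{\neg B\to P\}$. CPRHL rules: (Axiom) $\{Q\}\varepsilon\{Q\}$; (Cons) from $\{P'\}C\{Q'\}$ infer $\{P\}C\{Q\}$ if $P'\models P$, $Q\models Q'$; (Assign) from $\{P\}C\{Q\}$ infer $\{P[x:=E]\}x:=E;C\{Q\}$; (Or) from $\{P\}C_0;C\{Q\},\{P\}C_1;C\{Q\}$ infer $\{P\}(C_0\ \mathtt{or}\ C_1);C\{Q\}$; (While) from $\{\neg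 B\to P\}C'\{Q\}$ and $\{B\to P\}C;\mathtt{while}\ B\ \mathtt{do}\ C;C'\{Q\}$ infer $\{P\}\mathtt{while}\ B\ \mathtt{do}\ C;C'\{Q\}$. A CPRHL-pre-proof is a finite derivation tree from these rules together with a map sending each open leaf (leaf not an instance of Axiom) to a companion (inner node with the same triple); it is a CPRHL-proof if along every infinite path (following back-links) rules other than Cons are applied infinitely often. -}

module Defs where

open import Level using (Level; 0ℓ) renaming (suc to lsuc)
open import Data.Nat using (ℕ; zero; suc; _≤_; _≟_)
open import Data.Fin using (Fin)
open import Data.Vec using (Vec; []; _∷_; lookup)
open import Data.List using (List; []; _∷_; _++_)
open import Data.Product using (Σ; ∃; _×_; _,_)
open import Data.Sum using (_⊎_)
open import Data.Unit using (⊤)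
open import Data.Empty using (⊥)
open import Data.Bool using (if_then_else_)
open import Relation.Nullary using (¬_; does)
open import Relation.Binary.PropositionalEquality using (_≡_)
open import Relation.Binary.Construct.Closure.ReflexiveTransitive using (Star)
open import Function.Bundles using (_⇔_)

record Signature : Set₁ where
  field
    FunSym    : Set
    funArity  : FunSym → ℕ
    funInterp : (f : FunSym) → Vec ℕ (funArity f) → ℕ
    PredSym    : Set
    predArity  : PredSym → ℕ
    predInterp : (q : PredSym) → Vec ℕ (predArity q) → Set

open Signature public

Var : Set
Var = ℕ

State : Set
State = Var → ℕ

_[_↦_] : State → Var → ℕ → State
(σ [ x ↦ v ]) y = if does (x ≟ y) then v else σ y

module _ (S : Signature) where

  -- Terms with n bound (quantified) variables in scope (locally
  -- nameless: bound variables are de Bruijn indices, program variables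
  -- are names).

  data Term (n : ℕ) : Set where
    var  : Var → Term n
    bvar : Fin n → Term n
    lit  : ℕ → Term n
    app  : (f : FunSym S) → Vec (Term n) (funArity S f) → Term n

  Expr : Set
  Expr = Term 0

  data Cond (n : ℕ) : Set where
    pred  : (q : PredSym S) → Vec (Term n) (predArity S q) → Cond n
    _==_  : Term n → Term n → Cond n
    _≤ᶜ_  : Term n → Term n → Cond n
    notᶜ  : Cond n → Cond n
    andᶜ  : Cond n → Cond n → Cond n
    orᶜ   : Cond n → Cond n → Cond n

  BCond : Set
  BCond = Cond 0

  data Form (n : ℕ) : Set where
    atom : Cond n → Form n
    ¬ᶠ_  : Form n → Form n
    _∧ᶠ_ : Form n → Form n → Form n
    _∨ᶠ_ : Form n → Form n → Form n
    _⇒ᶠ_ : Form n → Form n → Form n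
    ∀ᶠ   : Form (suc n) → Form n
    ∃ᶠ   : Form (suc n) → Form n

  Assertion : Set
  Assertion = Form 0

  mutual
    evalT : ∀ {n} → State → Vec ℕ n → Term n → ℕ
    evalT σ ρ (var x)    = σ x
    evalT σ ρ (bvar i)   = lookup ρ i
    evalT σ ρ (lit k)    = k
    evalT σ ρ (app f ts) = funInterp S f (evalTs σ ρ ts)

    evalTs : ∀ {n k} → State → Vec ℕ n → Vec (Term n) k → Vec ℕ k
    evalTs σ ρ []       = []
    evalTs σ ρ (t ∷ ts) = evalT σ ρ t ∷ evalTs σ ρ ts

  holdsC : ∀ {n} → State → Vec ℕ n → Cond n → Set
  holdsC σ ρ (pred q ts) = predInterp S q (evalTs σ ρ ts)
  holdsC σ ρ (t == u)    = evalT σ ρ t ≡ evalT σ ρ u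
  holdsC σ ρ (t ≤ᶜ u)    = evalT σ ρ t ≤ evalT σ ρ u
  holdsC σ ρ (notᶜ b)    = ¬ holdsC σ ρ b
  holdsC σ ρ (andᶜ b c)  = holdsC σ ρ b × holdsC σ ρ c
  holdsC σ ρ (orᶜ b c)   = holdsC σ ρ b ⊎ holdsC σ ρ c

  satF : ∀ {n} → State → Vec ℕ n → Form n → Set
  satF σ ρ (atom b)  = holdsC σ ρ b
  satF σ ρ (¬ᶠ P)    = ¬ satF σ ρ P
  satF σ ρ (P ∧ᶠ Q)  = satF σ ρ P × satF σ ρ Q
  satF σ ρ (P ∨ᶠ Q)  = satF σ ρ P ⊎ satF σ ρ Q
  satF σ ρ (P ⇒ᶠ Q)  = satF σ ρ P → satF σ ρ Q
  satF σ ρ (∀ᶠ P)    = (v : ℕ) → satF σ (v ∷ ρ) P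
  satF σ ρ (∃ᶠ P)    = Σ ℕ λ v → satF σ (v ∷ ρ) P

  _⊨_ : State → Assertion → Set
  σ ⊨ P = satF σ [] P

  holds : State → BCond → Set
  holds σ B = holdsC σ [] B

  _⊨ᵉ_ : Assertion → Assertion → Set
  P ⊨ᵉ Q = ∀ σ → σ ⊨ P → σ ⊨ Q

  evalE : State → Expr → ℕ
  evalE σ E = evalT σ [] E

  -- Substitution P[x:=E] (capture-avoiding, since E has no bound vars)

  mutual
    wk : ∀ {n} → Term 0 → Term n
    wk (var x)    = var x
    wk (bvar ())
    wk (lit k)    = lit k
    wk (app f ts) = app f (wks ts)

    wks : ∀ {n k} → Vec (Term 0) k → Vec (Term n) k
    wks []       = []
    wks (t ∷ ts) = wk t ∷ wks ts

  mutual
    substT : ∀ {n} → Var → Expr → Term n → Term n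
    substT x E (var y)    = if does (x ≟ y) then wk E else var y
    substT x E (bvar i)   = bvar i
    substT x E (lit k)    = lit k
    substT x E (app f ts) = app f (substTs x E ts)

    substTs : ∀ {n k} → Var → Expr → Vec (Term n) k → Vec (Term n) k
    substTs x E []       = []
    substTs x E (t ∷ ts) = substT x E t ∷ substTs x E ts

  substC : ∀ {n} → Var → Expr → Cond n → Cond n
  substC x E (pred q ts) = pred q (substTs x E ts)
  substC x E (t == u)    = substT x E t == substT x E u
  substC x E (t ≤ᶜ u)    = substT x E t ≤ᶜ substT x E u
  substC x E (notᶜ b)    = notᶜ (substC x E b)
  substC x E (andᶜ b c)  = andᶜ (substC x E b) (substC x E c)
  substC x E (orᶜ b c)   = orᶜ (substC x E b) (substC x E c)

  substF : ∀ {n} → Var → Expr → Form n → Form n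
  substF x E (atom b)  = atom (substC x E b)
  substF x E (¬ᶠ P)    = ¬ᶠ substF x E P
  substF x E (P ∧ᶠ Q)  = substF x E P ∧ᶠ substF x E Q
  substF x E (P ∨ᶠ Q)  = substF x E P ∨ᶠ substF x E Q
  substF x E (P ⇒ᶠ Q)  = substF x E P ⇒ᶠ substF x E Q
  substF x E (∀ᶠ P)    = ∀ᶠ (substF x E P)
  substF x E (∃ᶠ P)    = ∃ᶠ (substF x E P)

  _[_≔_] : Assertion → Var → Expr → Assertion
  P [ x ≔ E ] = substF x E P

  -- Programs.  A program is a (possibly empty) sequence of statements;
  -- ε = [], and C₀;C₁ = C₀ ++ C₁ (sequencing is associative, with unit ε).

  data Stmt : Set where
    _:=_   : Var → Expr → Stmt
    while_∙_ : BCond → List Stmt → Stmt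
    _or_   : List Stmt → List Stmt → Stmt

  Prog : Set
  Prog = List Stmt

  ε : Prog
  ε = []

  Config : Set
  Config = Prog × State

  -- small-step semantics (a statement at the head of the sequence steps;
  -- this is the congruence rule for ; applied to the head statement)
  data _⟶_ : Config → Config → Set where
    step-assign : ∀ {x E C σ} →
      ((x := E) ∷ C , σ) ⟶ (C , σ [ x ↦ evalE σ E ])
    step-whileT : ∀ {B C C' σ} → holds σ B →
      ((while B ∙ C) ∷ C' , σ) ⟶ (C ++ ((while B ∙ C) ∷ C') , σ)
    step-whileF : ∀ {B C C' σ} → ¬ holds σ B →
      ((while B ∙ C) ∷ C' , σ) ⟶ (C' , σ)
    step-or₀ : ∀ {C₀ C₁ C σ} → ((C₀ or C₁) ∷ C , σ) ⟶ (C₀ ++ C , σ)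
    step-or₁ : ∀ {C₀ C₁ C σ} → ((C₀ or C₁) ∷ C , σ) ⟶ (C₁ ++ C , σ)

  _⟶*_ : Config → Config → Set
  _⟶*_ = Star _⟶_

  Valid : Assertion → Prog → Assertion → Set
  Valid P C Q = ∀ σ σ' → σ' ⊨ Q → (C , σ) ⟶* (ε , σ') → σ ⊨ P

  WPRExpressive : Set
  WPRExpressive = (Q : Assertion) (C : Prog) → Σ Assertion λ P →
    ∀ σ → (σ ⊨ P) ⇔ (∃ λ σ' → ((C , σ) ⟶* (ε , σ')) × σ' ⊨ Q)

  data PRHL : Assertion → Prog → Assertion → Set where
    axiom  : ∀ {Q} → PRHL Q ε Q
    assign : ∀ {Q x E} → PRHL (Q [ x ≔ E ]) ((x := E) ∷ []) Q
    seq    : ∀ {P R Q C₀ C₁} → PRHL P C₀ R → PRHL R C₁ Q → PRHL P (C₀ ++ C₁) Q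
    cons   : ∀ {P Q P' Q' C} → P ⊨ᵉ P' → Q' ⊨ᵉ Q → PRHL P C Q → PRHL P' C Q'
    choose : ∀ {P Q C₀ C₁} → PRHL P C₀ Q → PRHL P C₁ Q → PRHL P ((C₀ or C₁) ∷ []) Q
    while  : ∀ {P B C} → PRHL (atom B ⇒ᶠ P) C P →
             PRHL P ((while B ∙ C) ∷ []) ((¬ᶠ atom B) ⇒ᶠ P)

  data CDeriv : Assertion → Prog → Assertion → Set where
    axiom  : ∀ {Q} → CDeriv Q ε Q
    bud    : ∀ {P C Q} → CDeriv P C Q
    cons   : ∀ {P Q P' Q' C} → P' ⊨ᵉ P → Q ⊨ᵉ Q' → CDeriv P' C Q' → CDeriv P C Q
    assign : ∀ {P Q x E C} → CDeriv P C Q → CDeriv (P [ x ≔ E ]) ((x := E) ∷ C) Q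
    choose : ∀ {P Q C₀ C₁ C} → CDeriv P (C₀ ++ C) Q → CDeriv P (C₁ ++ C) Q →
             CDeriv P ((C₀ or C₁) ∷ C) Q
    while  : ∀ {P Q B C C'} → CDeriv ((¬ᶠ atom B) ⇒ᶠ P) C' Q →
             CDeriv (atom B ⇒ᶠ P) (C ++ ((while B ∙ C) ∷ C')) Q →
             CDeriv P ((while B ∙ C) ∷ C') Q

  data Pos : ∀ {P C Q} → CDeriv P C Q → Set where
    here    : ∀ {P C Q} {D : CDeriv P C Q} → Pos D
    inCons  : ∀ {P Q P' Q' C} {h : P' ⊨ᵉ P} {h' : Q ⊨ᵉ Q'} {D : CDeriv P' C Q'} →
              Pos D → Pos (cons {P} {Q} {P'} {Q'} {C} h h' D)
    inAssign : ∀ {P Q x E C} {D : CDeriv P C Q} → Pos D → Pos (assign {P} {Q} {x} {E} {C} D)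
    inOr₀   : ∀ {P Q C₀ C₁ C} {D₀ : CDeriv P (C₀ ++ C) Q} {D₁ : CDeriv P (C₁ ++ C) Q} →
              Pos D₀ → Pos (choose {P} {Q} {C₀} {C₁} {C} D₀ D₁)
    inOr₁   : ∀ {P Q C₀ C₁ C} {D₀ : CDeriv P (C₀ ++ C) Q} {D₁ : CDeriv P (C₁ ++ C) Q} →
              Pos D₁ → Pos (choose {P} {Q} {C₀} {C₁} {C} D₀ D₁)
    inWhile₀ : ∀ {P Q B C C'} {D₀ : CDeriv ((¬ᶠ atom B) ⇒ᶠ P) C' Q}
               {D₁ : CDeriv (atom B ⇒ᶠ P) (C ++ ((while B ∙ C) ∷ C')) Q} →
               Pos D₀ → Pos (while {P} {Q} {B} {C} {C'} D₀ D₁)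
    inWhile₁ : ∀ {P Q B C C'} {D₀ : CDeriv ((¬ᶠ atom B) ⇒ᶠ P) C' Q}
               {D₁ : CDeriv (atom B ⇒ᶠ P) (C ++ ((while B ∙ C) ∷ C')) Q} →
               Pos D₁ → Pos (while {P} {Q} {B} {C} {C'} D₀ D₁)

  data Rule : Set where
    axiomR budR consR assignR orR whileR : Rule

  ruleOf : ∀ {P C Q} → CDeriv P C Q → Rule
  ruleOf axiom       = axiomR
  ruleOf bud         = budR
  ruleOf (cons _ _ _) = consR
  ruleOf (assign _)  = assignR
  ruleOf (choose _ _)    = orR
  ruleOf (while _ _) = whileR

  ruleAt : ∀ {P C Q} {D : CDeriv P C Q} → Pos D → Rule
  ruleAt {D = D} here = ruleOf D
  ruleAt (inCons p)   = ruleAt p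
  ruleAt (inAssign p) = ruleAt p
  ruleAt (inOr₀ p)    = ruleAt p
  ruleAt (inOr₁ p)    = ruleAt p
  ruleAt (inWhile₀ p) = ruleAt p
  ruleAt (inWhile₁ p) = ruleAt p

  Triple : Set
  Triple = Assertion × Prog × Assertion

  tripleAt : ∀ {P C Q} {D : CDeriv P C Q} → Pos D → Triple
  tripleAt {P} {C} {Q} here = (P , C , Q)
  tripleAt (inCons p)   = tripleAt p
  tripleAt (inAssign p) = tripleAt p
  tripleAt (inOr₀ p)    = tripleAt p
  tripleAt (inOr₁ p)    = tripleAt p
  tripleAt (inWhile₀ p) = tripleAt p
  tripleAt (inWhile₁ p) = tripleAt p

  Inner : Rule → Set
  Inner consR   = ⊤
  Inner assignR = ⊤
  Inner orR     = ⊤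
  Inner whileR  = ⊤
  Inner axiomR  = ⊥
  Inner budR    = ⊥

  NonCons : Rule → Set
  NonCons assignR = ⊤
  NonCons orR     = ⊤
  NonCons whileR  = ⊤
  NonCons axiomR  = ⊥
  NonCons budR    = ⊥
  NonCons consR   = ⊥

  data Edge : ∀ {P C Q} {D : CDeriv P C Q} → Pos D → Pos D → Set where
    cons-here : ∀ {P Q P' Q' C} {h : P' ⊨ᵉ P} {h' : Q ⊨ᵉ Q'} {D : CDeriv P' C Q'} →
                Edge {D = cons {P} {Q} {P'} {Q'} {C} h h' D} here (inCons here)
    assign-here : ∀ {P Q x E C} {D : CDeriv P C Q} →
                  Edge {D = assign {P} {Q} {x} {E} {C} D} here (inAssign here)
    or-here₀ : ∀ {P Q C₀ C₁ C} {D₀ : CDeriv P (C₀ ++ C) Q} {D₁ : CDeriv P (C₁ ++ C) Q} →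
               Edge {D = choose {P} {Q} {C₀} {C₁} {C} D₀ D₁} here (inOr₀ here)
    or-here₁ : ∀ {P Q C₀ C₁ C} {D₀ : CDeriv P (C₀ ++ C) Q} {D₁ : CDeriv P (C₁ ++ C) Q} →
               Edge {D = choose {P} {Q} {C₀} {C₁} {C} D₀ D₁} here (inOr₁ here)
    while-here₀ : ∀ {P Q B C C'} {D₀ : CDeriv ((¬ᶠ atom B) ⇒ᶠ P) C' Q}
                  {D₁ : CDeriv (atom B ⇒ᶠ P) (C ++ ((while B ∙ C) ∷ C')) Q} →
                  Edge {D = while {P} {Q} {B} {C} {C'} D₀ D₁} here (inWhile₀ here)
    while-here₁ : ∀ {P Q B C C'} {D₀ : CDeriv ((¬ᶠ atom B) ⇒ᶠ P) C' Q}
                  {D₁ : CDeriv (atom B ⇒ᶠ P) (C ++ ((while B ∙ C) ∷ C')) Q} →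
                  Edge {D = while {P} {Q} {B} {C} {C'} D₀ D₁} here (inWhile₁ here)
    cons-in : ∀ {P Q P' Q' C} {h : P' ⊨ᵉ P} {h' : Q ⊨ᵉ Q'} {D : CDeriv P' C Q'}
              {p q : Pos D} → Edge p q → Edge {D = cons {P} {Q} {P'} {Q'} {C} h h' D} (inCons p) (inCons q)
    assign-in : ∀ {P Q x E C} {D : CDeriv P C Q} {p q : Pos D} →
                Edge p q → Edge {D = assign {P} {Q} {x} {E} {C} D} (inAssign p) (inAssign q)
    or-in₀ : ∀ {P Q C₀ C₁ C} {D₀ : CDeriv P (C₀ ++ C) Q} {D₁ : CDeriv P (C₁ ++ C) Q}
             {p q : Pos D₀} → Edge p q → Edge {D = choose {P} {Q} {C₀} {C₁} {C} D₀ D₁} (inOr₀ p) (inOr₀ q)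
    or-in₁ : ∀ {P Q C₀ C₁ C} {D₀ : CDeriv P (C₀ ++ C) Q} {D₁ : CDeriv P (C₁ ++ C) Q}
             {p q : Pos D₁} → Edge p q → Edge {D = choose {P} {Q} {C₀} {C₁} {C} D₀ D₁} (inOr₁ p) (inOr₁ q)
    while-in₀ : ∀ {P Q B C C'} {D₀ : CDeriv ((¬ᶠ atom B) ⇒ᶠ P) C' Q}
                {D₁ : CDeriv (atom B ⇒ᶠ P) (C ++ ((while B ∙ C) ∷ C')) Q}
                {p q : Pos D₀} → Edge p q → Edge {D = while {P} {Q} {B} {C} {C'} D₀ D₁} (inWhile₀ p) (inWhile₀ q)
    while-in₁ : ∀ {P Q B C C'} {D₀ : CDeriv ((¬ᶠ atom B) ⇒ᶠ P) C' Q}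
                {D₁ : CDeriv (atom B ⇒ᶠ P) (C ++ ((while B ∙ C) ∷ C')) Q}
                {p q : Pos D₁} → Edge p q → Edge {D = while {P} {Q} {B} {C} {C'} D₀ D₁} (inWhile₁ p) (inWhile₁ q)

  record PreProof (P : Assertion) (C : Prog) (Q : Assertion) : Set where
    field
      tree            : CDeriv P C Q
      companion       : (p : Pos tree) → ruleAt p ≡ budR → Pos tree
      companion-inner : (p : Pos tree) (b : ruleAt p ≡ budR) → Inner (ruleAt (companion p b))
      companion-same  : (p : Pos tree) (b : ruleAt p ≡ budR) → tripleAt (companion p b) ≡ tripleAt p

  module _ {P C Q} (pp : PreProof P C Q) where
    open PreProof pp

    data Next : Pos tree → Pos tree → Set where
      down : ∀ {p q} → Edge p q → Next p q
      back : ∀ {p} (b : ruleAt p ≡ budR) → Next p (companion p b)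

    record InfinitePath : Set where
      field
        node : ℕ → Pos tree
        next : ∀ n → Next (node n) (node (suc n))

    IsProof : Set
    IsProof = (π : InfinitePath) → ∀ n → Σ ℕ λ m → n ≤ m × NonCons (ruleAt (InfinitePath.node π m))

  CPRHLProvable : Assertion → Prog → Assertion → Set
  CPRHLProvable P C Q = Σ (PreProof P C Q) IsProof

{-# OPTIONS --safe #-}

-- Soundness is proved for runs of each fixed length. For PRHL this is induction on the
-- derivation, with strong induction on the length for the While rule. For CPRHL it is
-- strong induction on the length over all nodes at once: Assign, Or and While each consume
-- one step of the run, Axiom concerns the empty run, Cons keeps the run, and a bud shares
-- the triple of its companion. Following Cons premises and back-links from a node is
-- deterministic, and in a finite tree it must reach a node of another rule, since otherwise
-- it would cycle and yield an infinite path along which only Cons is applied.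
--
-- Completeness uses the weakest reverse precondition W C Q provided by expressivity, which
-- is closed under running backwards (W-step). For PRHL, W (while B C) Q is the loop
-- invariant. For CPRHL, the derivation of {W C Q} C {Q} follows the program and closes
-- every loop body with a bud whose companion is the While node of that loop, so every
-- cycle passes through a While rule.

module Submission where

open import Defs
open import Data.Bool using (Bool; true; false; T)
open import Data.Empty using (⊥-elim)
open import Data.Fin using (Fin; toℕ; _↑ˡ_; _↑ʳ_; splitAt) renaming (zero to fzero; suc to fsuc)
open import Data.Fin.Properties using (pigeonhole; toℕ<n; splitAt-↑ˡ; splitAt-↑ʳ)
open import Data.List using (List; []; _∷_; _++_)
open import Data.List.Properties using (++-assoc; ++-identityʳ)
open import Data.List.Relation.Unary.All using (All; []; _∷_; head)
open import Data.Nat using (ℕ; zero; suc; _+_; _≤_; _<_; _≟_; s≤s; z≤n; s≤s⁻¹)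
open import Data.Nat.GeneralisedArithmetic using (fold)
open import Data.Nat.Induction using (<-rec)
open import Data.Nat.Properties
  using ( ≤-refl; ≤-trans; <-≤-trans; ≤-<-trans; n<1+n; n≤1+n; m≤n⇒m≤1+n; m≤n⇒m<n∨m≡n
        ; suc-injective; anyUpTo?)
open import Data.Product using (Σ; ∃; _×_; _,_; proj₁; proj₂; map; map₁; map₂)
open import Data.Product.Function.NonDependent.Propositional using (_×-⇔_)
open import Data.Sum using (_⊎_; inj₁; inj₂)
open import Data.Sum.Function.Propositional using (_⊎-⇔_)
open import Data.Unit using (tt)
open import Data.Vec using (Vec; []; _∷_)
open import Function using (id; _∘_)
open import Function.Bundles using (_⇔_; mk⇔; Equivalence)
open import Function.Definitions using (Injective)
open import Function.Related.Propositional using (≡⇒)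
open import Function.Related.TypeIsomorphisms using (¬-cong-⇔; →-cong-⇔)
open import Relation.Binary.Construct.Closure.ReflexiveTransitive as Star using (_◅_; _◅◅_)
open import Relation.Binary.PropositionalEquality
open import Relation.Nullary using (¬_; does; yes; no)
open import Relation.Nullary.Decidable using (T?)

module _ {A : Set} (f : A → A) (x : A) where

  fold-cycle : ∀ {i j} → i < j → fold x f i ≡ fold x f j →
               ∀ m → ∃ λ l → l < j × fold x f m ≡ fold x f l
  fold-cycle i<j cycle zero = 0 , ≤-<-trans z≤n i<j , refl
  fold-cycle {i} i<j cycle (suc m) with fold-cycle i<j cycle m
  ... | l , l<j , eq with m≤n⇒m<n∨m≡n l<j
  ...   | inj₁ 1+l<j = suc l , 1+l<j , cong f eq
  ...   | inj₂ refl  = i , i<j , trans (cong f eq) (sym cycle)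

  fold-bounded : ∀ {N} (enc : A → Fin N) → Injective _≡_ _≡_ enc →
                 ∀ m → ∃ λ l → l < N × fold x f m ≡ fold x f l
  fold-bounded {N} enc enc-injective m
    with i , j , i<j , same ← pigeonhole (n<1+n N) (λ i → enc (fold x f (toℕ i)))
    with l , l<j , eq ← fold-cycle i<j (enc-injective same) m
    = l , <-≤-trans l<j (s≤s⁻¹ (toℕ<n j)) , eq

module _ (S : Signature) where

  private
    infix 4 _⊨ₛ_ _⊨ᵉₛ_
    infix 2 _⟶ₛ_ _⟶*ₛ_

    _⊨ₛ_ : State → Assertion S → Set
    _⊨ₛ_ = _⊨_ S

    _⊨ᵉₛ_ : Assertion S → Assertion S → Set
    _⊨ᵉₛ_ = _⊨ᵉ_ S

    _⟶ₛ_ : Config S → Config S → Set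
    _⟶ₛ_ = _⟶_ S

    _⟶*ₛ_ : Config S → Config S → Set
    _⟶*ₛ_ = _⟶*_ S

  mutual
    evalT-wk : ∀ {n} σ (ρ : Vec ℕ n) E → evalT S σ ρ (wk S E) ≡ evalE S σ E
    evalT-wk σ ρ (var x)    = refl
    evalT-wk σ ρ (lit k)    = refl
    evalT-wk σ ρ (app f ts) = cong (funInterp S f) (evalTs-wks σ ρ ts)

    evalTs-wks : ∀ {n k} σ (ρ : Vec ℕ n) (Es : Vec (Expr S) k) →
                 evalTs S σ ρ (wks S Es) ≡ evalTs S σ [] Es
    evalTs-wks σ ρ []       = refl
    evalTs-wks σ ρ (E ∷ Es) = cong₂ _∷_ (evalT-wk σ ρ E) (evalTs-wks σ ρ Es)

  module _ (x : Var) (E : Expr S) (σ : State) where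

    mutual
      evalT-substT : ∀ {n} (ρ : Vec ℕ n) t →
                     evalT S σ ρ (substT S x E t) ≡ evalT S (σ [ x ↦ evalE S σ E ]) ρ t
      evalT-substT ρ (var y) with does (x ≟ y)
      ... | true  = evalT-wk σ ρ E
      ... | false = refl
      evalT-substT ρ (bvar i)   = refl
      evalT-substT ρ (lit k)    = refl
      evalT-substT ρ (app f ts) = cong (funInterp S f) (evalTs-substTs ρ ts)

      evalTs-substTs : ∀ {n k} (ρ : Vec ℕ n) (ts : Vec (Term S n) k) →
                       evalTs S σ ρ (substTs S x E ts) ≡ evalTs S (σ [ x ↦ evalE S σ E ]) ρ ts
      evalTs-substTs ρ []       = refl
      evalTs-substTs ρ (t ∷ ts) = cong₂ _∷_ (evalT-substT ρ t) (evalTs-substTs ρ ts)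

    holdsC-substC : ∀ {n} (ρ : Vec ℕ n) b →
                    holdsC S σ ρ (substC S x E b) ≡ holdsC S (σ [ x ↦ evalE S σ E ]) ρ b
    holdsC-substC ρ (pred q ts) = cong (predInterp S q) (evalTs-substTs ρ ts)
    holdsC-substC ρ (t == u)    = cong₂ _≡_ (evalT-substT ρ t) (evalT-substT ρ u)
    holdsC-substC ρ (t ≤ᶜ u)    = cong₂ _≤_ (evalT-substT ρ t) (evalT-substT ρ u)
    holdsC-substC ρ (notᶜ b)    = cong ¬_ (holdsC-substC ρ b)
    holdsC-substC ρ (andᶜ b c)  = cong₂ _×_ (holdsC-substC ρ b) (holdsC-substC ρ c)
    holdsC-substC ρ (orᶜ b c)   = cong₂ _⊎_ (holdsC-substC ρ b) (holdsC-substC ρ c)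

    satF-substF : ∀ {n} (ρ : Vec ℕ n) P →
                  satF S σ ρ (substF S x E P) ⇔ satF S (σ [ x ↦ evalE S σ E ]) ρ P
    satF-substF ρ (atom b) = ≡⇒ (holdsC-substC ρ b)
    satF-substF ρ (¬ᶠ P)   = ¬-cong-⇔ (satF-substF ρ P)
    satF-substF ρ (P ∧ᶠ Q) = satF-substF ρ P ×-⇔ satF-substF ρ Q
    satF-substF ρ (P ∨ᶠ Q) = satF-substF ρ P ⊎-⇔ satF-substF ρ Q
    satF-substF ρ (P ⇒ᶠ Q) = →-cong-⇔ (satF-substF ρ P) (satF-substF ρ Q)
    satF-substF ρ (∀ᶠ P)   = mk⇔ (λ h v → to (h v)) (λ h v → from (h v))
      where open module IH {v} = Equivalence (satF-substF (v ∷ ρ) P)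
    satF-substF ρ (∃ᶠ P)   = mk⇔ (λ (v , h) → v , to h) (λ (v , h) → v , from h)
      where open module IH {v} = Equivalence (satF-substF (v ∷ ρ) P)

  ⊨-[≔] : ∀ {σ} P x E → σ ⊨ₛ _[_≔_] S P x E ⇔ σ [ x ↦ evalE S σ E ] ⊨ₛ P
  ⊨-[≔] {σ} P x E = satF-substF x E σ [] P

  step-++ : ∀ {C σ C' σ'} → (C , σ) ⟶ₛ (C' , σ') → ∀ D → (C ++ D , σ) ⟶ₛ (C' ++ D , σ')
  step-++ step-assign D = step-assign
  step-++ (step-whileT {B} {Cb} {C'} b) D rewrite ++-assoc Cb (while B ∙ Cb ∷ C') D = step-whileT b
  step-++ (step-whileF ¬b) D = step-whileF ¬b
  step-++ (step-or₀ {C₀} {C = C}) D rewrite ++-assoc C₀ C D = step-or₀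
  step-++ (step-or₁ {C₁ = C₁} {C = C}) D rewrite ++-assoc C₁ C D = step-or₁

  ⟶*-++ : ∀ {C σ C' σ'} → (C , σ) ⟶*ₛ (C' , σ') → ∀ D → (C ++ D , σ) ⟶*ₛ (C' ++ D , σ')
  ⟶*-++ Star.ε       D = Star.ε
  ⟶*-++ (st ◅ run) D = step-++ st D ◅ ⟶*-++ run D

  infixr 5 _▸_
  infix 2 _⟶[_]_

  data _⟶[_]_ : Config S → ℕ → Config S → Set where
    done : ∀ {c} → c ⟶[ 0 ] c
    _▸_  : ∀ {c d e n} → c ⟶ₛ d → d ⟶[ n ] e → c ⟶[ suc n ] e

  ⟶*⇒⟶[] : ∀ {c d} → c ⟶*ₛ d → ∃ λ n → c ⟶[ n ] d
  ⟶*⇒⟶[] Star.ε       = 0 , done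
  ⟶*⇒⟶[] (st ◅ run) = map suc (st ▸_) (⟶*⇒⟶[] run)

  data SplitRun (C₀ C₁ : Prog S) (σ σ' : State) (n : ℕ) : Set where
    split : ∀ {σ'' n₀ n₁} → n₁ ≤ n → (C₀ , σ) ⟶[ n₀ ] ([] , σ'') → (C₁ , σ'') ⟶[ n₁ ] ([] , σ') →
            SplitRun C₀ C₁ σ σ' n

  ▸-split : ∀ {C₀ C₀' C₁ σ σ'' σ' n} → (C₀ , σ) ⟶ₛ (C₀' , σ'') →
            SplitRun C₀' C₁ σ'' σ' n → SplitRun C₀ C₁ σ σ' (suc n)
  ▸-split st (split n₁≤n run₀ run₁) = split (m≤n⇒m≤1+n n₁≤n) (st ▸ run₀) run₁

  -- The equation C ≡ C₀ ++ C₁ keeps the recursion structural on the run when ++ is reassociated.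
  ⟶[]-split : ∀ C₀ C₁ {C σ σ' n} → C ≡ C₀ ++ C₁ → (C , σ) ⟶[ n ] ([] , σ') →
              SplitRun C₀ C₁ σ σ' n
  ⟶[]-split [] C₁ refl run = split ≤-refl done run
  ⟶[]-split (_ ∷ C₀) C₁ refl (step-assign ▸ run) =
    ▸-split step-assign (⟶[]-split C₀ C₁ refl run)
  ⟶[]-split (_ ∷ C₀) C₁ refl (step-whileT {B} {Cb} b ▸ run) =
    ▸-split (step-whileT b) (⟶[]-split (Cb ++ while B ∙ Cb ∷ C₀) C₁ (sym (++-assoc Cb _ C₁)) run)
  ⟶[]-split (_ ∷ C₀) C₁ refl (step-whileF ¬b ▸ run) =
    ▸-split (step-whileF ¬b) (⟶[]-split C₀ C₁ refl run)
  ⟶[]-split (_ ∷ C₀) C₁ refl (step-or₀ {C₀ = C} ▸ run) =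
    ▸-split step-or₀ (⟶[]-split (C ++ C₀) C₁ (sym (++-assoc C C₀ C₁)) run)
  ⟶[]-split (_ ∷ C₀) C₁ refl (step-or₁ {C₁ = C} ▸ run) =
    ▸-split step-or₁ (⟶[]-split (C ++ C₀) C₁ (sym (++-assoc C C₀ C₁)) run)

  -- Soundness of PRHL

  ValidIn : ℕ → Triple S → Set
  ValidIn n (P , C , Q) = ∀ {σ σ'} → σ' ⊨ₛ Q → (C , σ) ⟶[ n ] ([] , σ') → σ ⊨ₛ P

  ValidIn⇒Valid : ∀ {P C Q} → (∀ n → ValidIn n (P , C , Q)) → Valid S P C Q
  ValidIn⇒Valid valid σ σ' q run = let n , run' = ⟶*⇒⟶[] run in valid n q run'

  while-sound : ∀ {P B C} → (∀ n → ValidIn n (atom B ⇒ᶠ P , C , P)) →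
                ∀ n → ValidIn n (P , (while B ∙ C) ∷ [] , (¬ᶠ atom B) ⇒ᶠ P)
  while-sound {P} {B} {C} body = <-rec _ loop
    where
    loop : ∀ n → (∀ {m} → m < n → ValidIn m (P , (while B ∙ C) ∷ [] , (¬ᶠ atom B) ⇒ᶠ P)) →
           ValidIn n (P , (while B ∙ C) ∷ [] , (¬ᶠ atom B) ⇒ᶠ P)
    loop (suc n) _ q (step-whileF ¬b ▸ done) = q ¬b
    loop (suc n) _ q (step-whileF ¬b ▸ (() ▸ _))
    loop (suc n) ih q (step-whileT b ▸ run) with ⟶[]-split C _ refl run
    ... | split n₁≤n run₀ run₁ = body _ (ih (s≤s n₁≤n) q run₁) run₀ b

  PRHL⇒ValidIn : ∀ {P C Q} → PRHL S P C Q → ∀ n → ValidIn n (P , C , Q)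
  PRHL⇒ValidIn axiom _ q done = q
  PRHL⇒ValidIn axiom _ q (() ▸ _)
  PRHL⇒ValidIn (assign {Q} {x} {E}) _ q (step-assign ▸ done) = Equivalence.from (⊨-[≔] Q x E) q
  PRHL⇒ValidIn assign _ q (step-assign ▸ (() ▸ _))
  PRHL⇒ValidIn (seq {C₀ = C₀} d₀ d₁) _ q run with ⟶[]-split C₀ _ refl run
  ... | split _ run₀ run₁ = PRHL⇒ValidIn d₀ _ (PRHL⇒ValidIn d₁ _ q run₁) run₀
  PRHL⇒ValidIn (cons P⊨P' Q'⊨Q d) n q run = P⊨P' _ (PRHL⇒ValidIn d n (Q'⊨Q _ q) run)
  PRHL⇒ValidIn (choose {C₀ = C₀} d₀ _) (suc n) q (step-or₀ ▸ run) =
    PRHL⇒ValidIn d₀ n q (subst (λ C → (C , _) ⟶[ n ] _) (++-identityʳ C₀) run)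
  PRHL⇒ValidIn (choose {C₁ = C₁} _ d₁) (suc n) q (step-or₁ ▸ run) =
    PRHL⇒ValidIn d₁ n q (subst (λ C → (C , _) ⟶[ n ] _) (++-identityʳ C₁) run)
  PRHL⇒ValidIn (while {P} {B} {C} d) = while-sound {P} {B} {C} (PRHL⇒ValidIn d)

  PRHL-sound : ∀ {P C Q} → PRHL S P C Q → Valid S P C Q
  PRHL-sound {P} {C} {Q} d = ValidIn⇒Valid {P} {C} {Q} (PRHL⇒ValidIn d)

  -- Cyclic derivations and pre-proofs

  isLocal : Rule S → Bool
  isLocal consR = false
  isLocal budR  = false
  isLocal _     = true

  Local : Rule S → Set
  Local r = T (isLocal r)

  NonCons⇒Local : ∀ r → NonCons S r → Local r
  NonCons⇒Local assignR _ = tt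
  NonCons⇒Local orR     _ = tt
  NonCons⇒Local whileR  _ = tt
  NonCons⇒Local axiomR  ()
  NonCons⇒Local budR    ()
  NonCons⇒Local consR   ()

  ValidBelow : ∀ {P C Q} → ℕ → CDeriv S P C Q → Set
  ValidBelow n D = ∀ {m} → m < n → (q : Pos S D) → ValidIn m (tripleAt S q)

  local-sound : ∀ {P C Q n} {D : CDeriv S P C Q} (p : Pos S D) →
                Local (ruleAt S p) → ValidBelow n D → ValidIn n (tripleAt S p)
  local-sound {D = axiom} here _ _ q done = q
  local-sound {D = axiom} here _ _ q (() ▸ _)
  local-sound {D = bud} here ()
  local-sound {D = cons _ _ _} here ()
  local-sound {D = assign {P} {x = x} {E} _} here _ below q (step-assign ▸ run) =
    Equivalence.from (⊨-[≔] P x E) (below ≤-refl (inAssign here) q run)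
  local-sound {D = choose _ _} here _ below q (step-or₀ ▸ run) = below ≤-refl (inOr₀ here) q run
  local-sound {D = choose _ _} here _ below q (step-or₁ ▸ run) = below ≤-refl (inOr₁ here) q run
  local-sound {D = while _ _} here _ below q (step-whileT b ▸ run) = below ≤-refl (inWhile₁ here) q run b
  local-sound {D = while _ _} here _ below q (step-whileF ¬b ▸ run) = below ≤-refl (inWhile₀ here) q run ¬b
  local-sound (inCons p)   l below = local-sound p l (λ m<n q → below m<n (inCons q))
  local-sound (inAssign p) l below = local-sound p l (λ m<n q → below m<n (inAssign q))
  local-sound (inOr₀ p)    l below = local-sound p l (λ m<n q → below m<n (inOr₀ q))
  local-sound (inOr₁ p)    l below = local-sound p l (λ m<n q → below m<n (inOr₁ q))
  local-sound (inWhile₀ p) l below = local-sound p l (λ m<n q → below m<n (inWhile₀ q))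
  local-sound (inWhile₁ p) l below = local-sound p l (λ m<n q → below m<n (inWhile₁ q))

  consPremise : ∀ {P C Q} {D : CDeriv S P C Q} (p : Pos S D) → ruleAt S p ≡ consR →
                Σ (Pos S D) λ q → Edge S p q × (∀ {n} → ValidIn n (tripleAt S q) → ValidIn n (tripleAt S p))
  consPremise {D = cons P'⊨P Q⊨Q' _} here _ =
    inCons here , cons-here , λ valid q run → P'⊨P _ (valid (Q⊨Q' _ q) run)
  consPremise {D = axiom}      here ()
  consPremise {D = bud}        here ()
  consPremise {D = assign _}   here ()
  consPremise {D = choose _ _} here ()
  consPremise {D = while _ _}  here ()
  consPremise (inCons p)   c = map inCons   (map₁ cons-in)   (consPremise p c)
  consPremise (inAssign p) c = map inAssign (map₁ assign-in) (consPremise p c)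
  consPremise (inOr₀ p)    c = map inOr₀    (map₁ or-in₀)    (consPremise p c)
  consPremise (inOr₁ p)    c = map inOr₁    (map₁ or-in₁)    (consPremise p c)
  consPremise (inWhile₀ p) c = map inWhile₀ (map₁ while-in₀) (consPremise p c)
  consPremise (inWhile₁ p) c = map inWhile₁ (map₁ while-in₁) (consPremise p c)

  Edge-inner : ∀ {P C Q} {D : CDeriv S P C Q} {p q : Pos S D} → Edge S p q → Inner S (ruleAt S p)
  Edge-inner cons-here     = tt
  Edge-inner assign-here   = tt
  Edge-inner or-here₀      = tt
  Edge-inner or-here₁      = tt
  Edge-inner while-here₀   = tt
  Edge-inner while-here₁   = tt
  Edge-inner (cons-in e)   = Edge-inner e
  Edge-inner (assign-in e) = Edge-inner e
  Edge-inner (or-in₀ e)    = Edge-inner e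
  Edge-inner (or-in₁ e)    = Edge-inner e
  Edge-inner (while-in₀ e) = Edge-inner e
  Edge-inner (while-in₁ e) = Edge-inner e

  consDepth : ∀ {P C Q} → CDeriv S P C Q → ℕ
  consDepth (cons _ _ D) = suc (consDepth D)
  consDepth _            = 0

  consDepthAt : ∀ {P C Q} {D : CDeriv S P C Q} → Pos S D → ℕ
  consDepthAt {D = D} here = consDepth D
  consDepthAt (inCons p)   = consDepthAt p
  consDepthAt (inAssign p) = consDepthAt p
  consDepthAt (inOr₀ p)    = consDepthAt p
  consDepthAt (inOr₁ p)    = consDepthAt p
  consDepthAt (inWhile₀ p) = consDepthAt p
  consDepthAt (inWhile₁ p) = consDepthAt p

  Edge-consDepth : ∀ {P C Q} {D : CDeriv S P C Q} {p q : Pos S D} → Edge S p q →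
                   ruleAt S p ≡ consR → consDepthAt p ≡ suc (consDepthAt q)
  Edge-consDepth cons-here     _  = refl
  Edge-consDepth assign-here   ()
  Edge-consDepth or-here₀      ()
  Edge-consDepth or-here₁      ()
  Edge-consDepth while-here₀   ()
  Edge-consDepth while-here₁   ()
  Edge-consDepth (cons-in e)   = Edge-consDepth e
  Edge-consDepth (assign-in e) = Edge-consDepth e
  Edge-consDepth (or-in₀ e)    = Edge-consDepth e
  Edge-consDepth (or-in₁ e)    = Edge-consDepth e
  Edge-consDepth (while-in₀ e) = Edge-consDepth e
  Edge-consDepth (while-in₁ e) = Edge-consDepth e

  size premisesSize : ∀ {P C Q} → CDeriv S P C Q → ℕ
  size D = suc (premisesSize D)
  premisesSize axiom          = 0
  premisesSize bud            = 0
  premisesSize (cons _ _ D)   = size D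
  premisesSize (assign D)     = size D
  premisesSize (choose D₀ D₁) = size D₀ + size D₁
  premisesSize (while D₀ D₁)  = size D₀ + size D₁

  index : ∀ {P C Q} {D : CDeriv S P C Q} → Pos S D → Fin (size D)
  index here = fzero
  index (inCons p)                 = fsuc (index p)
  index (inAssign p)               = fsuc (index p)
  index (inOr₀ {D₁ = D₁} p)        = fsuc (index p ↑ˡ size D₁)
  index (inOr₁ {D₀ = D₀} p)        = fsuc (size D₀ ↑ʳ index p)
  index (inWhile₀ {D₁ = D₁} p)     = fsuc (index p ↑ˡ size D₁)
  index (inWhile₁ {D₀ = D₀} p)     = fsuc (size D₀ ↑ʳ index p)

  position : ∀ {P C Q} (D : CDeriv S P C Q) → Fin (size D) → Pos S D
  position D fzero = here
  position (cons _ _ D) (fsuc i) = inCons (position D i)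
  position (assign D)   (fsuc i) = inAssign (position D i)
  position (choose D₀ D₁) (fsuc i) with splitAt (size D₀) i
  ... | inj₁ i₀ = inOr₀ (position D₀ i₀)
  ... | inj₂ i₁ = inOr₁ (position D₁ i₁)
  position (while D₀ D₁) (fsuc i) with splitAt (size D₀) i
  ... | inj₁ i₀ = inWhile₀ (position D₀ i₀)
  ... | inj₂ i₁ = inWhile₁ (position D₁ i₁)

  position-index : ∀ {P C Q} {D : CDeriv S P C Q} (p : Pos S D) → position D (index p) ≡ p
  position-index here = refl
  position-index (inCons p)   = cong inCons (position-index p)
  position-index (inAssign p) = cong inAssign (position-index p)
  position-index (inOr₀ {D₀ = D₀} {D₁} p)
    rewrite splitAt-↑ˡ (size D₀) (index p) (size D₁) = cong inOr₀ (position-index p)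
  position-index (inOr₁ {D₀ = D₀} {D₁} p)
    rewrite splitAt-↑ʳ (size D₀) (size D₁) (index p) = cong inOr₁ (position-index p)
  position-index (inWhile₀ {D₀ = D₀} {D₁} p)
    rewrite splitAt-↑ˡ (size D₀) (index p) (size D₁) = cong inWhile₀ (position-index p)
  position-index (inWhile₁ {D₀ = D₀} {D₁} p)
    rewrite splitAt-↑ʳ (size D₀) (size D₁) (index p) = cong inWhile₁ (position-index p)

  index-injective : ∀ {P C Q} {D : CDeriv S P C Q} → Injective _≡_ _≡_ (index {D = D})
  index-injective {D = D} {p} {q} same =
    trans (sym (position-index p)) (trans (cong (position D) same) (position-index q))

  module _ {P C Q} (pp : PreProof S P C Q) where
    open PreProof pp

    Next-cons : ∀ {p q} → Next S pp p q → ruleAt S p ≡ consR → consDepthAt p ≡ suc (consDepthAt q)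
    Next-cons (down e) rule = Edge-consDepth e rule
    Next-cons (back b) rule with () ← trans (sym rule) b

    Next-axiom : ∀ {p q} → Next S pp p q → ¬ ruleAt S p ≡ axiomR
    Next-axiom (down e) rule = subst (Inner S) rule (Edge-inner e)
    Next-axiom (back b) rule with () ← trans (sym rule) b

    Next-bud : (∀ p b → NonCons S (ruleAt S (companion p b))) →
               ∀ {p q} → Next S pp p q → ruleAt S p ≡ budR → NonCons S (ruleAt S q)
    Next-bud _ (down e) rule = ⊥-elim (subst (Inner S) rule (Edge-inner e))
    Next-bud nonCons {p} (back b) _ = nonCons p b

    nonCons-companions⇒IsProof : (∀ p b → NonCons S (ruleAt S (companion p b))) → IsProof S pp
    nonCons-companions⇒IsProof nonCons π n = ahead _ n refl
      where
      open InfinitePath π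

      ahead : ∀ d n → consDepthAt (node n) ≡ d → Σ ℕ λ m → n ≤ m × NonCons S (ruleAt S (node m))
      ahead d n depth with ruleAt S (node n) in rule
      ... | assignR = n , ≤-refl , subst (NonCons S) (sym rule) tt
      ... | orR     = n , ≤-refl , subst (NonCons S) (sym rule) tt
      ... | whileR  = n , ≤-refl , subst (NonCons S) (sym rule) tt
      ... | budR    = suc n , n≤1+n n , Next-bud nonCons (next n) rule
      ... | axiomR  = ⊥-elim (Next-axiom (next n) rule)
      ... | consR with d | trans (sym depth) (Next-cons (next n) rule)
      ...   | suc d' | depth' =
        map₂ (map₁ (≤-trans (n≤1+n n))) (ahead d' (suc n) (suc-injective (sym depth')))

    hopFrom : ∀ p r → ruleAt S p ≡ r → Pos S tree
    hopFrom p consR rule = proj₁ (consPremise p rule)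
    hopFrom p budR  rule = companion p rule
    hopFrom p _     _    = p

    hop : Pos S tree → Pos S tree
    hop p = hopFrom p (ruleAt S p) refl

    hop-sound : ∀ {n} p → ValidIn n (tripleAt S (hop p)) → ValidIn n (tripleAt S p)
    hop-sound {n} p = byRule (ruleAt S p) refl
      where
      byRule : ∀ r (rule : ruleAt S p ≡ r) →
               ValidIn n (tripleAt S (hopFrom p r rule)) → ValidIn n (tripleAt S p)
      byRule consR   rule = proj₂ (proj₂ (consPremise p rule))
      byRule budR    rule = subst (ValidIn n) (companion-same p rule)
      byRule axiomR  _    = id
      byRule assignR _    = id
      byRule orR     _    = id
      byRule whileR  _    = id

    hop-next : ∀ p → ¬ Local (ruleAt S p) → Next S pp p (hop p)
    hop-next p = byRule (ruleAt S p) refl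
      where
      byRule : ∀ r (rule : ruleAt S p ≡ r) → ¬ Local r → Next S pp p (hopFrom p r rule)
      byRule consR   rule _       = down (proj₁ (proj₂ (consPremise p rule)))
      byRule budR    rule _       = back rule
      byRule axiomR  _    passive = ⊥-elim (passive tt)
      byRule assignR _    passive = ⊥-elim (passive tt)
      byRule orR     _    passive = ⊥-elim (passive tt)
      byRule whileR  _    passive = ⊥-elim (passive tt)

    module _ (isProof : IsProof S pp) where

      hops-reach-Local : ∀ p → ∃ λ k → Local (ruleAt S (fold p hop k))
      hops-reach-Local p with anyUpTo? (λ k → T? (isLocal (ruleAt S (fold p hop k)))) (size tree)
      ... | yes (k , _ , local) = k , local
      ... | no none =
        let m , _ , nonCons = isProof orbit 0 in ⊥-elim (passive m (NonCons⇒Local _ nonCons))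
        where
        passive : ∀ k → ¬ Local (ruleAt S (fold p hop k))
        passive k local with fold-bounded hop p index index-injective k
        ... | l , l<N , same = none (l , l<N , subst (Local ∘ ruleAt S) same local)

        orbit : InfinitePath S pp
        orbit = record { node = fold p hop ; next = λ k → hop-next _ (passive k) }

      hops-sound : ∀ {n} p k → ValidIn n (tripleAt S (fold p hop k)) → ValidIn n (tripleAt S p)
      hops-sound p zero    = id
      hops-sound p (suc k) = hops-sound p k ∘ hop-sound (fold p hop k)

      everywhere-sound : ∀ n (p : Pos S tree) → ValidIn n (tripleAt S p)
      everywhere-sound = <-rec _ step
        where
        step : ∀ n → ValidBelow n tree → ∀ p → ValidIn n (tripleAt S p)
        step n below p =
          let k , local = hops-reach-Local p in hops-sound p k (local-sound (fold p hop k) local below)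

      CPRHL-sound : Valid S P C Q
      CPRHL-sound = ValidIn⇒Valid {P} {C} {Q} (λ n → everywhere-sound n here)

  WhileNode : ∀ {P C Q} → CDeriv S P C Q → Triple S → Set
  WhileNode G t = Σ (Pos S G) λ c → ruleAt S c ≡ whileR × tripleAt S c ≡ t

  -- Γ lists the triples of the While nodes enclosing D, and ι locates D inside the tree G.
  ClosedUnder : ∀ {P C Q} → List (Triple S) → CDeriv S P C Q → Set
  ClosedUnder Γ D =
    ∀ {P' C' Q'} {G : CDeriv S P' C' Q'} (ι : Pos S D → Pos S G) →
    (∀ p → ruleAt S (ι p) ≡ ruleAt S p × tripleAt S (ι p) ≡ tripleAt S p) →
    All (WhileNode G) Γ → (p : Pos S D) → ruleAt S p ≡ budR → WhileNode G (tripleAt S p)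

  axiom-closed : ∀ {Γ Q} → ClosedUnder Γ (axiom {Q = Q})
  axiom-closed _ _ _ here ()

  bud-closed : ∀ {Γ P C Q} → ClosedUnder ((P , C , Q) ∷ Γ) (bud {P = P} {C} {Q})
  bud-closed _ _ whileNodes here _ = head whileNodes

  cons-closed : ∀ {Γ P Q P' Q' C} {P'⊨P : P' ⊨ᵉₛ P} {Q⊨Q' : Q ⊨ᵉₛ Q'} {D : CDeriv S P' C Q'} →
                ClosedUnder Γ D → ClosedUnder Γ (cons {P = P} {Q} {P'} {Q'} P'⊨P Q⊨Q' D)
  cons-closed closed ι ι-label ws (inCons p) = closed (ι ∘ inCons) (ι-label ∘ inCons) ws p

  assign-closed : ∀ {Γ P Q x E C} {D : CDeriv S P C Q} →
                  ClosedUnder Γ D → ClosedUnder Γ (assign {x = x} {E} D)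
  assign-closed closed ι ι-label ws (inAssign p) = closed (ι ∘ inAssign) (ι-label ∘ inAssign) ws p

  choose-closed : ∀ {Γ P Q C₀ C₁ C} {D₀ : CDeriv S P (C₀ ++ C) Q} {D₁ : CDeriv S P (C₁ ++ C) Q} →
                  ClosedUnder Γ D₀ → ClosedUnder Γ D₁ →
                  ClosedUnder Γ (choose {C₀ = C₀} {C₁} {C} D₀ D₁)
  choose-closed closed₀ _ ι ι-label ws (inOr₀ p) = closed₀ (ι ∘ inOr₀) (ι-label ∘ inOr₀) ws p
  choose-closed _ closed₁ ι ι-label ws (inOr₁ p) = closed₁ (ι ∘ inOr₁) (ι-label ∘ inOr₁) ws p

  while-closed : ∀ {Γ P Q B C C'} {D₀ : CDeriv S ((¬ᶠ atom B) ⇒ᶠ P) C' Q}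
                 {D₁ : CDeriv S (atom B ⇒ᶠ P) (C ++ ((while B ∙ C) ∷ C')) Q} →
                 ClosedUnder Γ D₀ → ClosedUnder ((P , (while B ∙ C) ∷ C' , Q) ∷ Γ) D₁ →
                 ClosedUnder Γ (while D₀ D₁)
  while-closed closed₀ _ ι ι-label ws (inWhile₀ p) =
    closed₀ (ι ∘ inWhile₀) (ι-label ∘ inWhile₀) ws p
  while-closed _ closed₁ ι ι-label ws (inWhile₁ p) =
    closed₁ (ι ∘ inWhile₁) (ι-label ∘ inWhile₁) ((ι here , ι-label here) ∷ ws) p

  closed⇒CPRHLProvable : ∀ {P C Q} (D : CDeriv S P C Q) → ClosedUnder [] D → CPRHLProvable S P C Q
  closed⇒CPRHLProvable D closed = pp , nonCons-companions⇒IsProof pp nonCons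
    where
    companionOf : (p : Pos S D) → ruleAt S p ≡ budR → WhileNode D (tripleAt S p)
    companionOf = closed id (λ _ → refl , refl) []

    pp : PreProof S _ _ _
    pp = record
      { tree            = D
      ; companion       = λ p b → proj₁ (companionOf p b)
      ; companion-inner = λ p b → subst (Inner S) (sym (proj₁ (proj₂ (companionOf p b)))) tt
      ; companion-same  = λ p b → proj₂ (proj₂ (companionOf p b))
      }

    nonCons : ∀ p b → NonCons S (ruleAt S (proj₁ (companionOf p b)))
    nonCons p b = subst (NonCons S) (sym (proj₁ (proj₂ (companionOf p b)))) tt

  -- Completeness

  module _ (expressive : WPRExpressive S) where

    W : Prog S → Assertion S → Assertion S
    W C Q = proj₁ (expressive Q C)

    W-intro : ∀ {C Q σ σ'} → (C , σ) ⟶*ₛ ([] , σ') → σ' ⊨ₛ Q → σ ⊨ₛ W C Q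
    W-intro {C} {Q} {σ} {σ'} run q = Equivalence.from (proj₂ (expressive Q C) σ) (σ' , run , q)

    W-elim : ∀ {C Q σ} → σ ⊨ₛ W C Q → ∃ λ σ' → ((C , σ) ⟶*ₛ ([] , σ')) × σ' ⊨ₛ Q
    W-elim {C} {Q} {σ} = Equivalence.to (proj₂ (expressive Q C) σ)

    W-⟶* : ∀ {C C' Q σ σ'} → (C , σ) ⟶*ₛ (C' , σ') → σ' ⊨ₛ W C' Q → σ ⊨ₛ W C Q
    W-⟶* run w = let _ , run' , q = W-elim w in W-intro (run ◅◅ run') q

    W-step : ∀ {C C' Q σ σ'} → (C , σ) ⟶ₛ (C' , σ') → σ' ⊨ₛ W C' Q → σ ⊨ₛ W C Q
    W-step st = W-⟶* (st ◅ Star.ε)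

    W-ε : ∀ {Q} → Q ⊨ᵉₛ W [] Q
    W-ε _ = W-intro Star.ε

    W-seq : ∀ {C₀ C₁ Q} → W C₀ (W C₁ Q) ⊨ᵉₛ W (C₀ ++ C₁) Q
    W-seq {C₁ = C₁} _ w = let _ , run , w' = W-elim w in W-⟶* (⟶*-++ run C₁) w'

    W-assign : ∀ {x E C Q} → _[_≔_] S (W C Q) x E ⊨ᵉₛ W ((x := E) ∷ C) Q
    W-assign {x} {E} {C} {Q} _ w = W-step step-assign (Equivalence.to (⊨-[≔] (W C Q) x E) w)

    Valid⇒W⊨ : ∀ {P C Q} → Valid S P C Q → W C Q ⊨ᵉₛ P
    Valid⇒W⊨ valid σ w = let σ' , run , q = W-elim w in valid σ σ' q run

    mutual
      PRHL-W : ∀ C Q → PRHL S (W C Q) C Q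
      PRHL-W []      Q = cons W-ε (λ _ → id) (axiom {Q = Q})
      PRHL-W (s ∷ C) Q = cons W-seq (λ _ → id) (seq (PRHL-W-stmt s (W C Q)) (PRHL-W C Q))

      -- The postcondition W [] Q matches the continuation [] left behind by a step,
      -- e.g. from C₀ or C₁ to C₀ ++ [].
      PRHL-W-stmt : ∀ s Q → PRHL S (W (s ∷ []) Q) (s ∷ []) Q
      PRHL-W-stmt (x := E)    Q = cons W-assign W-ε (assign {Q = W [] Q})
      PRHL-W-stmt (C₀ or C₁)  Q = choose (branch step-or₀) (branch step-or₁)
        where
        branch : ∀ {C} → (∀ {σ} → ((C₀ or C₁) ∷ [] , σ) ⟶ₛ (C ++ [] , σ)) →
                 PRHL S (W ((C₀ or C₁) ∷ []) Q) C Q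
        branch {C} st = cons (λ _ → W-step st ∘ W-seq _) W-ε (PRHL-W C (W [] Q))
      PRHL-W-stmt (while B ∙ C) Q =
        cons (λ _ → id) (λ _ q ¬b → W-step (step-whileF ¬b) (W-ε _ q))
          (while {P = I} (cons (λ _ w b → W-step (step-whileT b) (W-seq _ w)) (λ _ → id) (PRHL-W C I)))
        where
        I = W ((while B ∙ C) ∷ []) Q

    PRHL-complete : ∀ {P C Q} → Valid S P C Q → PRHL S P C Q
    PRHL-complete {P} {C} {Q} valid = cons (Valid⇒W⊨ {P} valid) (λ _ → id) (PRHL-W C Q)

    wpr-tree : ∀ {Q} C R → CDeriv S (W R Q) R Q → CDeriv S (W (C ++ R) Q) (C ++ R) Q
    wpr-tree []                  R k = k
    wpr-tree ((x := E) ∷ C)      R k = cons W-assign (λ _ → id) (assign (wpr-tree C R k))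
    wpr-tree ((C₀ or C₁) ∷ C)    R k =
      choose (cons (λ _ → W-step step-or₀) (λ _ → id) (wpr-tree C₀ (C ++ R) (wpr-tree C R k)))
             (cons (λ _ → W-step step-or₁) (λ _ → id) (wpr-tree C₁ (C ++ R) (wpr-tree C R k)))
    wpr-tree ((while B ∙ Cb) ∷ C) R k =
      while (cons (λ _ w ¬b → W-step (step-whileF ¬b) w) (λ _ → id) (wpr-tree C R k))
            (cons (λ _ w b → W-step (step-whileT b) w) (λ _ → id)
                  (wpr-tree Cb ((while B ∙ Cb) ∷ C ++ R) bud))

    wpr-tree-closed : ∀ {Γ Q} C R {k : CDeriv S (W R Q) R Q} →
                      ClosedUnder Γ k → ClosedUnder Γ (wpr-tree C R k)
    wpr-tree-closed []                   R closed = closed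
    wpr-tree-closed ((x := E) ∷ C)       R closed = cons-closed (assign-closed (wpr-tree-closed C R closed))
    wpr-tree-closed ((C₀ or C₁) ∷ C)     R closed =
      choose-closed (cons-closed (wpr-tree-closed C₀ (C ++ R) (wpr-tree-closed C R closed)))
                    (cons-closed (wpr-tree-closed C₁ (C ++ R) (wpr-tree-closed C R closed)))
    wpr-tree-closed ((while B ∙ Cb) ∷ C) R closed =
      while-closed (cons-closed (wpr-tree-closed C R closed))
                   (cons-closed (wpr-tree-closed Cb _ bud-closed))

    CPRHL-complete : ∀ {P C Q} → Valid S P C Q → CPRHLProvable S P C Q
    CPRHL-complete {P} {C} {Q} valid =
      subst (λ C → CPRHLProvable S P C Q) (++-identityʳ C) (closed⇒CPRHLProvable tree closed)
      where
      W⊨P : W (C ++ []) Q ⊨ᵉₛ P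
      W⊨P σ w = Valid⇒W⊨ {P} valid σ (subst (λ C → σ ⊨ₛ W C Q) (++-identityʳ C) w)

      tree : CDeriv S P (C ++ []) Q
      tree = cons W⊨P (λ _ → id) (wpr-tree C [] (cons W-ε (λ _ → id) (axiom {Q = Q})))

      closed : ClosedUnder [] tree
      closed = cons-closed (wpr-tree-closed C [] (cons-closed axiom-closed))

theorem4p5 : (S : Signature) → WPRExpressive S →
    (P : Assertion S) (C : Prog S) (Q : Assertion S) →
    (Valid S P C Q ⇔ PRHL S P C Q) × (Valid S P C Q ⇔ CPRHLProvable S P C Q)
theorem4p5 S expressive P C Q =
  mk⇔ (PRHL-complete S expressive) (PRHL-sound S) ,
  mk⇔ (CPRHL-complete S expressive) (λ (pp , isProof) → CPRHL-sound S pp isProof)
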